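{- Let $H$ be a graph possibly with loops and let $G$ be a finite multigraph without loops equipped with an $H$-coloring $c:E(G)\to V(H)$. Then: (a) If $G$ has a closed Euler dynamic $H$-trail, then $L_n^H(G)$ is hamiltonian for every $n\ge 2$. (b) If $L_n^H(G)$ is hamiltonian for some $n\ge 3$, then $G$ has a closed Euler dynamic $H$-trail. (c) $G$ has a closed Euler dynamic $H$-trail if and only if $L_n^H(G)$ is hamiltonian for every $n\ge 3$.
   Context: An $H$-coloring of $G$ is a map $c:E(G)\to V(H)$. Two distinct edges of $G$ are parallel if they have the same two end vertices. A dynamic $H$-walk in $G$ is a sequence $W=(v_0,e_0^1,\ldots,e_0^{k_0},v_1,e_1^1,\ldots,e_1^{k_1},v_2,\ldots,v_{n-1},e_{n-1}^1,\ldots,e_{n-1}^{k_{n-1}},v_n)$ with $n\ge 1$, where $k_i\ge 1$ and every $e_i^j$ is an edge of $G$ joining $v_i$ and $v_{i+1}$, such that $c(e_i^{k_i})c(e_{i+1}^1)\in E(H)$ for each $i\in\{0,\ldots,n-2\}$ (here $ab\in E(H)$ means $a$ and $b$ are adjacent in $H$, a loop being required when $a=b$). A dynamic $H$-trail is a dynamic $H$-walk with no repeated edge. It is closed if either (a) $v_0=v_n$ and $c(e_{n-1}^{k_{n-1}})c(e_0^1)\in E(H)$, or (b) $v_1=v_n$ and $e_{n-1}^{k_{n-1}}$ and $e_0^1$ are parallel. It is Euler if its set of edges is $E(G)$. For $n\ge 2$, $L_n^H(G)$ is the simple graph obtained as follows: for each edge $e$ of $G$ with ends $u,v$ take two vertices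 $f(u,e)$ and $f(v,e)$ and join them by a path with $n-2$ new internal vertices (for $n=2$, simply an edge); in addition, $f(u,e)$ and $f(u,g)$ are adjacent iff $e\ne g$ and $c(e)c(g)\in E(H)$; and $f(u,e)$ and $f(v,g)$ with $u\ne v$ are adjacent iff $e$ and $g$ are (distinct) parallel edges of $G$. No other edges. A graph is hamiltonian if it has a cycle through all its vertices. -}

module Defs where

open import Data.Nat using (ℕ; zero; suc; _∸_)
open import Data.Fin using (Fin; zero; suc; toℕ; fromℕ; inject₁)
open import Data.Product using (Σ; ∃; _×_; _,_)
open import Data.Sum using (_⊎_)
open import Relation.Nullary using (¬_)
open import Relation.Binary.PropositionalEquality using (_≡_; _≢_)

record HamCycle {V : Set} (A : V → V → Set) : Set where
  field
    len      : ℕ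
    cyc      : Fin (suc (suc (suc len))) → V
    injective : ∀ i j → cyc i ≡ cyc j → i ≡ j
    surjective : ∀ v → ∃ λ i → cyc i ≡ v
    step     : ∀ (i : Fin (suc (suc len))) → A (cyc (inject₁ i)) (cyc (suc i))
    close    : A (cyc (fromℕ (suc (suc len)))) (cyc zero)

Hamiltonian : {V : Set} → (V → V → Set) → Set
Hamiltonian A = HamCycle A

-- H : vertex type VH with adjacency Adj (loops allowed: Adj a a).
-- G : finite loopless multigraph with vertices Fin p, edges Fin m,
--     edge e has ends src e and tgt e (src e ≢ tgt e assumed in the theorem).
-- c : Fin m → VH, an H-coloring.

module _ {VH : Set} (Adj : VH → VH → Set) (p m : ℕ)
         (src tgt : Fin m → Fin p) (c : Fin m → VH) where

  Joins : Fin m → Fin p → Fin p → Set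
  Joins e u w = (src e ≡ u × tgt e ≡ w) ⊎ (src e ≡ w × tgt e ≡ u)

  Parallel : Fin m → Fin m → Set
  Parallel e g = e ≢ g × ((src e ≡ src g × tgt e ≡ tgt g) ⊎ (src e ≡ tgt g × tgt e ≡ src g))

  -- Dynamic H-walk (v₀, e₀¹…e₀^{k₀}, v₁, …, v_n) with n = len + 1 ≥ 1,
  -- k_i = mult i + 1 ≥ 1.
  record DynWalk : Set where
    field
      len    : ℕ
      vert   : Fin (suc (suc len)) → Fin p
      mult   : Fin (suc len) → ℕ
      edge   : (i : Fin (suc len)) → Fin (suc (mult i)) → Fin m
      joins  : ∀ i j → Joins (edge i j) (vert (inject₁ i)) (vert (suc i))
      compat : ∀ (i : Fin len) →
               Adj (c (edge (inject₁ i) (fromℕ (mult (inject₁ i))))) (c (edge (suc i) zero))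

    Pos : Set
    Pos = Σ (Fin (suc len)) (λ i → Fin (suc (mult i)))

    edgeAt : Pos → Fin m
    edgeAt (i , j) = edge i j

    firstEdge : Fin m
    firstEdge = edge zero zero

    lastEdge : Fin m
    lastEdge = edge (fromℕ len) (fromℕ (mult (fromℕ len)))

    IsTrail : Set
    IsTrail = ∀ x y → edgeAt x ≡ edgeAt y → x ≡ y

    IsEuler : Set
    IsEuler = ∀ e → ∃ λ x → edgeAt x ≡ e

    IsClosed : Set
    IsClosed = (vert zero ≡ vert (fromℕ (suc len)) × Adj (c lastEdge) (c firstEdge))
             ⊎ (vert (suc zero) ≡ vert (fromℕ (suc len)) × Parallel lastEdge firstEdge)

  HasClosedEulerDynTrail : Set
  HasClosedEulerDynTrail =
    Σ DynWalk (λ W → DynWalk.IsTrail W × DynWalk.IsEuler W × DynWalk.IsClosed W)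

  -- L_n^H(G), n ≥ 2.  Vertices: Fin m × Fin n; (e , i) is the i-th vertex
  -- of the path of e, where (e , 0) = f(src e, e), (e , n-1) = f(tgt e, e),
  -- and the others are the n-2 internal vertices.

  IsEnd : (n : ℕ) → Fin m × Fin n → Fin p → Set
  IsEnd n (e , i) u = (toℕ i ≡ 0 × src e ≡ u) ⊎ (toℕ i ≡ n ∸ 1 × tgt e ≡ u)

  LAdj : (n : ℕ) → Fin m × Fin n → Fin m × Fin n → Set
  LAdj n (e , i) (g , j) =
      (e ≡ g × (toℕ i ≡ suc (toℕ j) ⊎ toℕ j ≡ suc (toℕ i)))
    ⊎ (e ≢ g × Σ (Fin p) (λ u → IsEnd n (e , i) u × IsEnd n (g , j) u × Adj (c e) (c g)))
    ⊎ Σ (Fin p) (λ u → Σ (Fin p) (λ v →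
         u ≢ v × IsEnd n (e , i) u × IsEnd n (g , j) v × Parallel e g))

{-# OPTIONS --safe #-}

-- Both sides of the equivalence are compared with an intermediate object: a cyclic
-- sequence of oriented edges using every edge of G once, in which each arc either
-- continues the previous one at its end vertex with an H-adjacent colour, or is
-- parallel to it with the same orientation (EulerArcCycle).  Maximal runs of
-- parallel arcs are exactly the steps of a closed Euler dynamic trail.
--
-- Traversing the path of L_n^H(G) belonging to each arc, in the arc's direction,
-- turns such a sequence into a Hamiltonian cycle: the transition from one arc to the
-- next is precisely an edge of L_n^H(G) between the two ends of the paths.
-- Conversely, for n ≥ 3 the inner vertices of every path have degree 2, so once a
-- Hamiltonian cycle enters a path at one end it runs through the whole path to the
-- other end.  Cutting the cycle where it changes edge thus splits it into m blocks
-- of n vertices, and the arcs of the blocks, in cyclic order, form an EulerArcCycle.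

module Submission where

open import Defs

open import Data.Bool using (Bool; true; false; not)
open import Data.Bool.Properties using (not-involutive)
open import Data.Empty using (⊥; ⊥-elim)
open import Data.Fin as Fin
  using (Fin; zero; suc; toℕ; fromℕ; fromℕ<; inject₁; opposite; combine; remQuot; punchOut)
import Data.Fin.Properties as Finₚ
open import Data.Fin.Properties
  using ( toℕ-inject₁; toℕ-fromℕ; toℕ-fromℕ<; fromℕ<-cong; toℕ-injective; toℕ<n; toℕ≤pred[n]
        ; opposite-prop; opposite-involutive; remQuot-combine; combine-remQuot
        ; cantor-schröder-bernstein; any?; punchOut-injective; injective⇒≤ )
open import Data.List
  using (List; []; _∷_; _++_; map; concat; concatMap; applyUpTo; tabulate; lookup; length; last; head)
open import Data.List.Properties
  using (++-identityʳ; last-map; map-∘; map-++; map-tabulate; map-applyUpTo; length-++)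
open import Data.List.Membership.Propositional using (_∈_)
open import Data.List.Membership.Propositional.Properties
  using (∈-lookup; ∈-applyUpTo⁺; ∈-map⁺; ∈-map⁻; ∈-tabulate⁺; ∈-tabulate⁻; ∈-++⁺ˡ; ∈-++⁺ʳ; ∈-++⁻)
import Data.List.Relation.Unary.All as All
open import Data.List.Relation.Unary.All using (_∷_)
open import Data.List.Relation.Unary.AllPairs using (_∷_)
open import Data.List.Relation.Unary.Any using (here; there; index)
open import Data.List.Relation.Unary.Any.Properties using (lookup-index)
open import Data.List.Relation.Unary.Linked using (Linked; []; [-]; _∷_)
import Data.List.Relation.Unary.Linked.Properties as Linked
open import Data.List.Relation.Unary.Unique.Propositional using (Unique; [])
import Data.List.Relation.Unary.Unique.Propositional.Properties as Unique
import Data.Maybe as Maybe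
open import Data.Maybe using (just)
open import Data.Maybe.Properties using (just-injective)
open import Data.Maybe.Relation.Binary.Connected using (Connected; just; drop-just)
open import Data.Nat using (ℕ; zero; suc; _+_; _*_; _∸_; _%_; _≤_; _<_; _<?_; z≤n; s≤s; s≤s⁻¹; NonZero)
open import Data.Nat.DivMod
  using (m%n<n; %-distribˡ-+; m%n%n≡m%n; [m+n]%n≡m%n; m<n⇒m%n≡m; m≤n⇒[n∸m]%m≡n%m; n%n≡0)
open import Data.Nat.Properties
  using ( ≤-refl; ≤-trans; ≤-antisym; ≤-reflexive; <-irrefl; <-cmp; <⇒≢; ≮⇒≥; suc-injective; 1+n≢0
        ; n≤1+n; m≤n⇒m≤1+n; m≤n+m; m≤m+n; m<n+m; +-comm; +-assoc; +-suc; +-identityʳ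
        ; +-cancelʳ-≡; +-cancelʳ-<; +-mono-<; +-monoʳ-<; *-monoˡ-≤
        ; +-∸-assoc; n∸n≡0; m∸n+n≡m; m∸[m∸n]≡n; m∸n≤m )
open import Data.Nat.Tactic.RingSolver using (solve-∀)
open import Data.Product using (Σ; ∃; _×_; _,_; proj₁; proj₂; uncurry)
open import Data.Sum using (_⊎_; inj₁; inj₂)
open import Function using (_∘_)
open import Function.Bundles using (_⇔_; mk⇔)
open import Relation.Binary.Definitions using (Symmetric; tri<; tri≈; tri>)
open import Relation.Binary.PropositionalEquality
open import Relation.Nullary using (¬_; yes; no)

module _ {a} {A : Set a} where

  lastOf : A → List A → A
  lastOf x []       = x
  lastOf _ (y ∷ ys) = lastOf y ys

  last-∷ : ∀ x (xs : List A) → last (x ∷ xs) ≡ just (lastOf x xs)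
  last-∷ x []       = refl
  last-∷ _ (y ∷ ys) = last-∷ y ys

  last-lookup : ∀ x (xs : List A) → last (x ∷ xs) ≡ just (lookup (x ∷ xs) (fromℕ (length xs)))
  last-lookup x []       = refl
  last-lookup _ (y ∷ ys) = last-lookup y ys

  last-tabulate : ∀ {k} (f : Fin (suc k) → A) → last (tabulate f) ≡ just (f (fromℕ k))
  last-tabulate {zero}  f = refl
  last-tabulate {suc k} f = last-tabulate (f ∘ suc)

  last-++-∷ : ∀ (xs : List A) y ys → last (xs ++ y ∷ ys) ≡ last (y ∷ ys)
  last-++-∷ []            y ys = refl
  last-++-∷ (x ∷ [])      y ys = refl
  last-++-∷ (x ∷ x′ ∷ xs) y ys = last-++-∷ (x′ ∷ xs) y ys

  lastOf-applyUpTo : ∀ (f : ℕ → A) k → lastOf (f 0) (applyUpTo (f ∘ suc) k) ≡ f k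
  lastOf-applyUpTo f zero    = refl
  lastOf-applyUpTo f (suc k) = lastOf-applyUpTo (f ∘ suc) k

  lastOf-∈ : ∀ x y (ys : List A) → lastOf x (y ∷ ys) ∈ y ∷ ys
  lastOf-∈ _ y []       = here refl
  lastOf-∈ _ y (z ∷ zs) = there (lastOf-∈ y z zs)

  lookup-injective : ∀ {xs : List A} → Unique xs → ∀ {i j} → lookup xs i ≡ lookup xs j → i ≡ j
  lookup-injective (_ ∷ _)   {zero}  {zero}  _  = refl
  lookup-injective (x∉ ∷ _)  {zero}  {suc j} eq = ⊥-elim (All.lookup x∉ (∈-lookup j) eq)
  lookup-injective (x∉ ∷ _)  {suc i} {zero}  eq = ⊥-elim (All.lookup x∉ (∈-lookup i) (sym eq))
  lookup-injective (_ ∷ xs!) {suc i} {suc j} eq = cong suc (lookup-injective xs! eq)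

  map-Unique⇒injective : ∀ {b} {B : Set b} (f : A → B) {xs x y} →
                         Unique (map f xs) → x ∈ xs → y ∈ xs → f x ≡ f y → x ≡ y
  map-Unique⇒injective f _         (here refl) (here refl) _  = refl
  map-Unique⇒injective f (fx∉ ∷ _) (here refl) (there y∈) eq = ⊥-elim (All.lookup fx∉ (∈-map⁺ f y∈) eq)
  map-Unique⇒injective f (fx∉ ∷ _) (there x∈) (here refl) eq = ⊥-elim (All.lookup fx∉ (∈-map⁺ f x∈) (sym eq))
  map-Unique⇒injective f (_ ∷ fxs!) (there x∈) (there y∈) eq = map-Unique⇒injective f fxs! x∈ y∈ eq

  module _ {r} {R : A → A → Set r} where

    Linked-tabulate⁺ : ∀ {k} (f : Fin (suc k) → A) →
                       (∀ i → R (f (inject₁ i)) (f (suc i))) → Linked R (tabulate f)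
    Linked-tabulate⁺ {zero}  f _    = [-]
    Linked-tabulate⁺ {suc k} f step = step zero ∷ Linked-tabulate⁺ (f ∘ suc) (step ∘ suc)

    Linked-lookup : ∀ {x xs} → Linked R (x ∷ xs) →
                    ∀ i → R (lookup (x ∷ xs) (inject₁ i)) (lookup (x ∷ xs) (suc i))
    Linked-lookup [-]      ()
    Linked-lookup (r ∷ _)  zero    = r
    Linked-lookup (_ ∷ rs) (suc i) = Linked-lookup rs i

Hamiltonian-fromList : ∀ {V : Set} {R : V → V → Set} (xs : List V) → 3 ≤ length xs →
                       Unique xs → (∀ v → v ∈ xs) → Linked R xs →
                       Connected R (last xs) (head xs) → Hamiltonian R
Hamiltonian-fromList (_ ∷ [])     (s≤s ())
Hamiltonian-fromList (_ ∷ _ ∷ []) (s≤s (s≤s ()))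
Hamiltonian-fromList {R = R} xs@(x ∷ xs′@(_ ∷ _ ∷ zs)) _ xs! complete linked closing = record
  { len        = length zs
  ; cyc        = lookup xs
  ; injective  = λ _ _ → lookup-injective xs!
  ; surjective = λ v → index (complete v) , sym (lookup-index (complete v))
  ; step       = Linked-lookup linked
  ; close      = drop-just (subst (λ w → Connected R w (just x)) (last-lookup x xs′) closing)
  }

-- Positions of a dynamic walk

Positions : (k : ℕ) → (Fin k → ℕ) → Set
Positions k μ = Σ (Fin k) (λ i → Fin (suc (μ i)))

shift : ∀ {k} {μ : Fin (suc k) → ℕ} → Positions k (μ ∘ suc) → Positions (suc k) μ
shift (i , j) = suc i , j

allPositions : ∀ k μ → List (Positions k μ)
allPositions zero    μ = []
allPositions (suc k) μ = tabulate (λ j → zero , j) ++ map shift (allPositions k (μ ∘ suc))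

∈-allPositions : ∀ k μ (P : Positions k μ) → P ∈ allPositions k μ
∈-allPositions (suc k) μ (zero  , j) = ∈-++⁺ˡ (∈-tabulate⁺ {f = λ j → (zero , j)} j)
∈-allPositions (suc k) μ (suc i , j) =
  ∈-++⁺ʳ (tabulate (λ j → zero , j)) (∈-map⁺ shift (∈-allPositions k (μ ∘ suc) (i , j)))

allPositions-Unique : ∀ k μ → Unique (allPositions k μ)
allPositions-Unique zero    μ = []
allPositions-Unique (suc k) μ = Unique.++⁺
  (Unique.tabulate⁺ {f = λ j → zero , j} λ { refl → refl })
  (Unique.map⁺ {f = shift} (λ { refl → refl }) (allPositions-Unique k (μ ∘ suc)))
  (λ (P∈ , P∈′) → disjoint P∈ P∈′)
  where
  disjoint : ∀ {P} → P ∈ tabulate (λ j → zero , j) → P ∈ map shift (allPositions k (μ ∘ suc)) → ⊥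
  disjoint P∈ P∈′ with ∈-tabulate⁻ {f = λ j → (zero , j)} P∈ | ∈-map⁻ shift P∈′
  ... | _ , refl | _ , _ , ()

map-allPositions : ∀ {b} {B : Set b} k μ (f : Positions k μ → B) →
                   map f (allPositions k μ) ≡ concat (tabulate λ i → tabulate λ j → f (i , j))
map-allPositions zero    μ f = refl
map-allPositions (suc k) μ f = begin
  map f (tabulate (λ j → zero , j) ++ map shift (allPositions k (μ ∘ suc)))
    ≡⟨ map-++ f (tabulate (λ j → zero , j)) _ ⟩
  map f (tabulate (λ j → zero , j)) ++ map f (map shift (allPositions k (μ ∘ suc)))
    ≡⟨ cong₂ _++_ (map-tabulate (λ j → zero , j) f) (sym (map-∘ (allPositions k (μ ∘ suc)))) ⟩
  tabulate (λ j → f (zero , j)) ++ map (f ∘ shift) (allPositions k (μ ∘ suc))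
    ≡⟨ cong (tabulate (λ j → f (zero , j)) ++_) (map-allPositions k (μ ∘ suc) (f ∘ shift)) ⟩
  concat (tabulate λ i → tabulate λ j → f (i , j)) ∎
  where open ≡-Reasoning

last-allPositions : ∀ k μ → last (allPositions (suc k) μ) ≡ just (fromℕ k , fromℕ (μ (fromℕ k)))
last-allPositions zero    μ =
  trans (cong last (++-identityʳ (tabulate (λ j → zero , j)))) (last-tabulate (λ j → zero , j))
last-allPositions (suc k) μ = begin
  last (tabulate (λ j → zero , j) ++ map shift (allPositions (suc k) (μ ∘ suc)))
    ≡⟨ last-++-∷ (tabulate (λ j → zero , j)) _ _ ⟩
  last (map shift (allPositions (suc k) (μ ∘ suc)))
    ≡⟨ last-map shift (allPositions (suc k) (μ ∘ suc)) ⟩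
  Maybe.map shift (last (allPositions (suc k) (μ ∘ suc)))
    ≡⟨ cong (Maybe.map shift) (last-allPositions k (μ ∘ suc)) ⟩
  just (fromℕ (suc k) , fromℕ (μ (fromℕ (suc k)))) ∎
  where open ≡-Reasoning

Linked-allPositions : ∀ k μ (R : Positions (suc k) μ → Positions (suc k) μ → Set) →
                      (∀ i (j : Fin (μ i)) → R (i , inject₁ j) (i , suc j)) →
                      (∀ (i : Fin k) → R (inject₁ i , fromℕ (μ (inject₁ i))) (suc i , zero)) →
                      Linked R (allPositions (suc k) μ)
Linked-allPositions zero μ R within _ =
  subst (Linked R) (sym (++-identityʳ _)) (Linked-tabulate⁺ (λ j → zero , j) (within zero))
Linked-allPositions (suc k) μ R within across = Linked.++⁺
  (Linked-tabulate⁺ (λ j → zero , j) (within zero))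
  (subst (λ w → Connected R w (just (suc zero , zero)))
         (sym (last-tabulate (λ j → (zero , j))))
         (just (across zero)))
  (Linked.map⁺ (Linked-allPositions k (μ ∘ suc) (λ P Q → R (shift P) (shift Q))
                                    (within ∘ suc) (across ∘ suc)))

-- A Hamiltonian cycle as a periodic sequence

module _ (n : ℕ) .{{_ : NonZero n}} where

  %-congʳ-+ : ∀ d a b → a % n ≡ b % n → (d + a) % n ≡ (d + b) % n
  %-congʳ-+ d a b eq = begin
    (d + a) % n             ≡⟨ %-distribˡ-+ d a n ⟩
    (d % n + a % n) % n     ≡⟨ cong (λ r → (d % n + r) % n) eq ⟩
    (d % n + b % n) % n     ≡⟨ %-distribˡ-+ d b n ⟨
    (d + b) % n             ∎
    where open ≡-Reasoning

  %-suc : ∀ k → suc k % n ≡ suc (k % n) % n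
  %-suc k = %-congʳ-+ 1 k (k % n) (sym (m%n%n≡m%n k n))

  -- d + a % n lies in [d, d + n), so reducing it mod n either leaves it or subtracts n.
  %-shift-≢ : ∀ d a → 0 < d → d < n → (d + a) % n ≢ a % n
  %-shift-≢ d a 0<d d<n eq = distinct (trans (%-congʳ-+ d (a % n) a (m%n%n≡m%n a n)) eq)
    where
    open ≡-Reasoning
    r = a % n
    distinct : (d + r) % n ≢ r
    distinct eq′ with d + r <? n
    ... | yes d+r<n = <⇒≢ (m<n+m r 0<d) (trans (sym eq′) (m<n⇒m%n≡m d+r<n))
    ... | no  d+r≮n = <⇒≢ d<n (+-cancelʳ-≡ r d n (begin
        d + r               ≡⟨ m∸n+n≡m n≤d+r ⟨
        d + r ∸ n + n       ≡⟨ cong (_+ n) wrapped ⟩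
        r + n               ≡⟨ +-comm r n ⟩
        n + r               ∎))
      where
      n≤d+r : n ≤ d + r
      n≤d+r = ≮⇒≥ d+r≮n
      wrapped : d + r ∸ n ≡ r
      wrapped = begin
        d + r ∸ n           ≡⟨ m<n⇒m%n≡m (+-cancelʳ-< n (d + r ∸ n) n
                                 (subst (_< n + n) (sym (m∸n+n≡m n≤d+r)) (+-mono-< d<n (m%n<n a n)))) ⟨
        (d + r ∸ n) % n     ≡⟨ m≤n⇒[n∸m]%m≡n%m n≤d+r ⟩
        (d + r) % n         ≡⟨ eq′ ⟩
        r                   ∎

module CyclicIndexing {V : Set} {R : V → V → Set} (H : HamCycle R) where
  open HamCycle H

  N : ℕ
  N = suc (suc (suc len))

  -- Opaque, so that unification sees `at k` rather than a term in `k % N`.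
  opaque
    at : ℕ → V
    at k = cyc (fromℕ< (m%n<n k N))

    at-cong : ∀ {a b} → a % N ≡ b % N → at a ≡ at b
    at-cong {a} {b} eq = cong cyc (fromℕ<-cong _ _ eq (m%n<n a N) (m%n<n b N))

    at-injective : ∀ {a b} → at a ≡ at b → a % N ≡ b % N
    at-injective {a} {b} eq = begin
      a % N                      ≡⟨ toℕ-fromℕ< (m%n<n a N) ⟨
      toℕ (fromℕ< (m%n<n a N))   ≡⟨ cong toℕ (injective _ _ eq) ⟩
      toℕ (fromℕ< (m%n<n b N))   ≡⟨ toℕ-fromℕ< (m%n<n b N) ⟩
      b % N                      ∎
      where open ≡-Reasoning

    at≡cyc : ∀ k (i : Fin N) → toℕ i ≡ k % N → at k ≡ cyc i
    at≡cyc k i eq = cong cyc (toℕ-injective (trans (toℕ-fromℕ< (m%n<n k N)) (sym eq)))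

  at-periodic : ∀ a → at (a + N) ≡ at a
  at-periodic a = at-cong ([m+n]%n≡m%n a N)

  at-suc-cong : ∀ {a b} → at a ≡ at b → at (suc a) ≡ at (suc b)
  at-suc-cong {a} {b} eq = at-cong (%-congʳ-+ N 1 a b (at-injective eq))

  at-suc-injective : ∀ {a b} → at (suc a) ≡ at (suc b) → at a ≡ at b
  at-suc-injective {a} {b} eq = begin
    at a                         ≡⟨ at-periodic a ⟨
    at (a + N)                   ≡⟨ cong at (wrap a) ⟩
    at (suc (suc len) + suc a)   ≡⟨ at-cong (%-congʳ-+ N (suc (suc len)) (suc a) (suc b) (at-injective eq)) ⟩
    at (suc (suc len) + suc b)   ≡⟨ cong at (wrap b) ⟨
    at (b + N)                   ≡⟨ at-periodic b ⟩
    at b                         ∎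
    where
    open ≡-Reasoning
    wrap : ∀ a → a + N ≡ suc (suc len) + suc a
    wrap a = trans (+-comm a N) (sym (+-suc (suc (suc len)) a))

  at-distinct : ∀ d a → 0 < d → d < N → at (d + a) ≢ at a
  at-distinct d a 0<d d<N eq = %-shift-≢ N d a 0<d d<N (at-injective eq)

  at-toℕ : ∀ (i : Fin N) → at (toℕ i) ≡ cyc i
  at-toℕ i = at≡cyc (toℕ i) i (sym (m<n⇒m%n≡m (toℕ<n i)))

  at-suc-surjective : ∀ v → ∃ λ k → at (suc k) ≡ v
  at-suc-surjective v = toℕ i + suc (suc len) , (begin
    at (suc (toℕ i + suc (suc len)))   ≡⟨ cong at (+-suc (toℕ i) (suc (suc len))) ⟨
    at (toℕ i + N)                     ≡⟨ at-periodic (toℕ i) ⟩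
    at (toℕ i)                         ≡⟨ at-toℕ i ⟩
    cyc i                              ≡⟨ cyc-i≡v ⟩
    v                                  ∎)
    where
    open ≡-Reasoning
    i = proj₁ (surjective v)
    cyc-i≡v = proj₂ (surjective v)

  at-step : ∀ k → R (at k) (at (suc k))
  at-step k with suc (k % N) <? N
  ... | yes k%N+1<N = subst₂ R (sym (at≡cyc k (inject₁ i) (trans (toℕ-inject₁ i) toℕ-i)))
                               (sym (at≡cyc (suc k) (suc i) (begin
                                 suc (toℕ i)          ≡⟨ cong suc toℕ-i ⟩
                                 suc (k % N)          ≡⟨ m<n⇒m%n≡m k%N+1<N ⟨
                                 suc (k % N) % N      ≡⟨ %-suc N k ⟨
                                 suc k % N            ∎)))
                               (step i)
    where
    open ≡-Reasoning
    i : Fin (suc (suc len))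
    i = fromℕ< (s≤s⁻¹ k%N+1<N)
    toℕ-i : toℕ i ≡ k % N
    toℕ-i = toℕ-fromℕ< (s≤s⁻¹ k%N+1<N)
  ... | no  k%N+1≮N = subst₂ R (sym (at≡cyc k (fromℕ (suc (suc len))) (trans (toℕ-fromℕ _) (suc-injective (sym k%N+1≡N)))))
                               (sym (at≡cyc (suc k) zero (sym (begin
                                 suc k % N            ≡⟨ %-suc N k ⟩
                                 suc (k % N) % N      ≡⟨ cong (_% N) k%N+1≡N ⟩
                                 N % N                ≡⟨ n%n≡0 N ⟩
                                 0                    ∎))))
                               close
    where
    open ≡-Reasoning
    k%N+1≡N : suc (k % N) ≡ N
    k%N+1≡N = ≤-antisym (m%n<n k N) (≮⇒≥ k%N+1≮N)

cycle-length : ∀ {a b} {R : Fin a × Fin b → Fin a × Fin b → Set} (H : HamCycle R) →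
               suc (suc (suc (HamCycle.len H))) ≡ a * b
cycle-length {a} {b} H = cantor-schröder-bernstein encode-injective decode-injective
  where
  open HamCycle H
  encode : Fin (suc (suc (suc len))) → Fin (a * b)
  encode k = uncurry combine (cyc k)
  encode-injective : ∀ {k l} → encode k ≡ encode l → k ≡ l
  encode-injective {k} {l} eq = injective k l (begin
    cyc k                          ≡⟨ remQuot-combine (proj₁ (cyc k)) (proj₂ (cyc k)) ⟨
    remQuot b (encode k)           ≡⟨ cong (remQuot b) eq ⟩
    remQuot b (encode l)           ≡⟨ remQuot-combine (proj₁ (cyc l)) (proj₂ (cyc l)) ⟩
    cyc l                          ∎)
    where open ≡-Reasoning
  decode : Fin (a * b) → Fin (suc (suc (suc len)))
  decode z = proj₁ (surjective (remQuot {a} b z))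
  decode-injective : ∀ {z w} → decode z ≡ decode w → z ≡ w
  decode-injective {z} {w} eq = begin
    z                                  ≡⟨ combine-remQuot {a} b z ⟨
    uncurry combine (remQuot {a} b z)  ≡⟨ cong (uncurry combine) (begin
      remQuot {a} b z                    ≡⟨ proj₂ (surjective (remQuot {a} b z)) ⟨
      cyc (decode z)                     ≡⟨ cong cyc eq ⟩
      cyc (decode w)                     ≡⟨ proj₂ (surjective (remQuot {a} b w)) ⟩
      remQuot {a} b w                    ∎) ⟩
    uncurry combine (remQuot {a} b w)  ≡⟨ combine-remQuot {a} b w ⟩
    w                                  ∎
    where open ≡-Reasoning

inject₁≢suc : ∀ {k} (j : Fin k) → inject₁ j ≢ suc j
inject₁≢suc zero    ()
inject₁≢suc (suc j) eq = inject₁≢suc j (Finₚ.suc-injective eq)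

injective⇒surjective : ∀ {k} (f : Fin k → Fin k) → (∀ {x y} → f x ≡ f y → x ≡ y) → ∀ y → ∃ λ x → f x ≡ y
injective⇒surjective {suc k} f f-injective y with any? (λ x → f x Fin.≟ y)
... | yes hit = hit
... | no  miss = ⊥-elim (<-irrefl refl (injective⇒≤ g-injective))
  where
  y≢f : ∀ x → y ≢ f x
  y≢f x eq = miss (x , sym eq)
  g : Fin (suc k) → Fin k
  g x = punchOut (y≢f x)
  g-injective : ∀ {x z} → g x ≡ g z → x ≡ z
  g-injective {x} {z} eq = f-injective (punchOut-injective (y≢f x) (y≢f z) eq)

module LineGraph {VH : Set} (Adj : VH → VH → Set) (p m : ℕ) (src tgt : Fin m → Fin p)
                 (loopless : ∀ e → src e ≢ tgt e) (c : Fin m → VH) where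

  L : (n : ℕ) → Fin m × Fin n → Fin m × Fin n → Set
  L = LAdj Adj p m src tgt c

  EndOf : (n : ℕ) → Fin m × Fin n → Fin p → Set
  EndOf = IsEnd Adj p m src tgt c

  _∥_ : Fin m → Fin m → Set
  _∥_ = Parallel Adj p m src tgt c

  Walk : Set
  Walk = DynWalk Adj p m src tgt c

  ∥-sym : ∀ {e g} → e ∥ g → g ∥ e
  ∥-sym (e≢g , inj₁ (s≡s , t≡t)) = e≢g ∘ sym , inj₁ (sym s≡s , sym t≡t)
  ∥-sym (e≢g , inj₂ (s≡t , t≡s)) = e≢g ∘ sym , inj₂ (sym t≡s , sym s≡t)

  Arc : Set
  Arc = Fin m × Bool

  start end : Arc → Fin p
  start (e , false) = src e
  start (e , true)  = tgt e
  end   (e , false) = tgt e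
  end   (e , true)  = src e

  start≢end : ∀ x → start x ≢ end x
  start≢end (e , false) = loopless e
  start≢end (e , true)  = loopless e ∘ sym

  SameEnds : Fin m → Fin m → Set
  SameEnds e g = (src e ≡ src g × tgt e ≡ tgt g) ⊎ (src e ≡ tgt g × tgt e ≡ src g)

  aligned⇒SameEnds : ∀ x y → start x ≡ start y → end x ≡ end y → SameEnds (proj₁ x) (proj₁ y)
  aligned⇒SameEnds (e , false) (g , false) s≡s e≡e = inj₁ (s≡s , e≡e)
  aligned⇒SameEnds (e , false) (g , true)  s≡s e≡e = inj₂ (s≡s , e≡e)
  aligned⇒SameEnds (e , true)  (g , false) s≡s e≡e = inj₂ (e≡e , s≡s)
  aligned⇒SameEnds (e , true)  (g , true)  s≡s e≡e = inj₁ (e≡e , s≡s)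

  Consecutive : Arc → Arc → Set
  Consecutive x y = (end x ≡ start y × Adj (c (proj₁ x)) (c (proj₁ y)))
                  ⊎ (start x ≡ start y × end x ≡ end y × proj₁ x ∥ proj₁ y)

  Consecutive-irreflexive : ∀ x → ¬ Consecutive x x
  Consecutive-irreflexive x (inj₁ (end≡start , _)) = start≢end x (sym end≡start)
  Consecutive-irreflexive x (inj₂ (_ , _ , x≢x , _)) = x≢x refl

  ∥⇒aligned : ∀ x y → proj₁ x ∥ proj₁ y → end x ≢ start y → start x ≡ start y × end x ≡ end y
  ∥⇒aligned (e , false) (g , false) (_ , inj₁ (s≡s , t≡t)) _   = s≡s , t≡t
  ∥⇒aligned (e , false) (g , false) (_ , inj₂ (_ , t≡s))   e≢s = ⊥-elim (e≢s t≡s)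
  ∥⇒aligned (e , false) (g , true)  (_ , inj₁ (_ , t≡t))   e≢s = ⊥-elim (e≢s t≡t)
  ∥⇒aligned (e , false) (g , true)  (_ , inj₂ (s≡t , t≡s)) _   = s≡t , t≡s
  ∥⇒aligned (e , true)  (g , false) (_ , inj₁ (s≡s , _))   e≢s = ⊥-elim (e≢s s≡s)
  ∥⇒aligned (e , true)  (g , false) (_ , inj₂ (s≡t , t≡s)) _   = t≡s , s≡t
  ∥⇒aligned (e , true)  (g , true)  (_ , inj₁ (s≡s , t≡t)) _   = t≡t , s≡s
  ∥⇒aligned (e , true)  (g , true)  (_ , inj₂ (s≡t , _))   e≢s = ⊥-elim (e≢s s≡t)

  record EulerArcCycle : Set where
    field
      first    : Arc
      rest     : List Arc
      linked   : Linked Consecutive (first ∷ rest)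
      closing  : Consecutive (lastOf first rest) first
      edges!   : Unique (map proj₁ (first ∷ rest))
      complete : ∀ e → e ∈ map proj₁ (first ∷ rest)

  module Paths (n′ : ℕ) where

    n : ℕ
    n = suc (suc n′)

    orient : Bool → Fin n → Fin n
    orient false i = i
    orient true  i = opposite i

    orient-involutive : ∀ d i → orient d (orient d i) ≡ i
    orient-involutive false i = refl
    orient-involutive true  i = opposite-involutive i

    orient-injective : ∀ d {i j} → orient d i ≡ orient d j → i ≡ j
    orient-injective d {i} {j} eq =
      trans (sym (orient-involutive d i)) (trans (cong (orient d) eq) (orient-involutive d j))

    pathVertex : Arc → Fin n → Fin m × Fin n
    pathVertex (e , d) i = e , orient d i

    firstVertex lastVertex : Arc → Fin m × Fin n
    firstVertex x = pathVertex x zero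
    lastVertex  x = pathVertex x (fromℕ (suc n′))

    path : Arc → List (Fin m × Fin n)
    path x = tabulate (pathVertex x)

    firstVertex-start : ∀ x → EndOf n (firstVertex x) (start x)
    firstVertex-start (e , false) = inj₁ (refl , refl)
    firstVertex-start (e , true)  = inj₂ (toℕ-fromℕ (suc n′) , refl)

    lastVertex-end : ∀ x → EndOf n (lastVertex x) (end x)
    lastVertex-end (e , false) = inj₂ (toℕ-fromℕ (suc n′) , refl)
    lastVertex-end (e , true)  = inj₁ ((begin
      toℕ (opposite (fromℕ (suc n′)))   ≡⟨ opposite-prop (fromℕ (suc n′)) ⟩
      suc n′ ∸ toℕ (fromℕ (suc n′))     ≡⟨ cong (suc n′ ∸_) (toℕ-fromℕ (suc n′)) ⟩
      suc n′ ∸ suc n′                   ≡⟨ n∸n≡0 (suc n′) ⟩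
      0                                 ∎) , refl)
      where open ≡-Reasoning

    path-step : ∀ x i → L n (pathVertex x (inject₁ i)) (pathVertex x (suc i))
    path-step (e , false) i = inj₁ (refl , inj₂ (cong suc (sym (toℕ-inject₁ i))))
    path-step (e , true)  i = inj₁ (refl , inj₁ (begin
      toℕ (opposite (inject₁ i))   ≡⟨ opposite-prop (inject₁ i) ⟩
      suc n′ ∸ toℕ (inject₁ i)     ≡⟨ cong (suc n′ ∸_) (toℕ-inject₁ i) ⟩
      suc n′ ∸ toℕ i               ≡⟨ +-∸-assoc 1 (toℕ≤pred[n] i) ⟩
      suc (n′ ∸ toℕ i)             ≡⟨ cong suc (opposite-prop (suc i)) ⟨
      suc (toℕ (opposite (suc i))) ∎))
      where open ≡-Reasoning

    Consecutive⇒L : ∀ x y → Consecutive x y → proj₁ x ≢ proj₁ y → L n (lastVertex x) (firstVertex y)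
    Consecutive⇒L x y (inj₁ (end≡start , adj)) x≢y =
      inj₂ (inj₁ (x≢y , end x , lastVertex-end x ,
                  subst (EndOf n (firstVertex y)) (sym end≡start) (firstVertex-start y) , adj))
    Consecutive⇒L x y (inj₂ (start≡start , _ , x∥y)) _ =
      inj₂ (inj₂ (end x , start y , (λ eq → start≢end x (trans start≡start (sym eq))) ,
                  lastVertex-end x , firstVertex-start y , x∥y))

    ∈-path⇒edge : ∀ x {v} → v ∈ path x → proj₁ v ≡ proj₁ x
    ∈-path⇒edge x v∈ = cong proj₁ (proj₂ (∈-tabulate⁻ {f = pathVertex x} v∈))

    ∈-path : ∀ x i → (proj₁ x , i) ∈ path x
    ∈-path x i = subst (_∈ path x) (cong (proj₁ x ,_) (orient-involutive (proj₂ x) i))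
                       (∈-tabulate⁺ {f = pathVertex x} (orient (proj₂ x) i))

    ∈-concatPaths⇒edge : ∀ xs {v} → v ∈ concatMap path xs → proj₁ v ∈ map proj₁ xs
    ∈-concatPaths⇒edge (x ∷ xs) v∈ with ∈-++⁻ (path x) v∈
    ... | inj₁ v∈x  = here (∈-path⇒edge x v∈x)
    ... | inj₂ v∈xs = there (∈-concatPaths⇒edge xs v∈xs)

    ∈-concatPaths : ∀ xs e i → e ∈ map proj₁ xs → (e , i) ∈ concatMap path xs
    ∈-concatPaths (x ∷ xs) e i (here refl) = ∈-++⁺ˡ (∈-path x i)
    ∈-concatPaths (x ∷ xs) e i (there e∈)  = ∈-++⁺ʳ (path x) (∈-concatPaths xs e i e∈)

    concatPaths-Unique : ∀ xs → Unique (map proj₁ xs) → Unique (concatMap path xs)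
    concatPaths-Unique []       _            = []
    concatPaths-Unique (x ∷ xs) (x∉ ∷ edges!) = Unique.++⁺
      (Unique.tabulate⁺ {f = pathVertex x} (orient-injective (proj₂ x) ∘ cong proj₂))
      (concatPaths-Unique xs edges!)
      (λ (v∈x , v∈xs) → All.lookup x∉
         (subst (_∈ map proj₁ xs) (∈-path⇒edge x v∈x) (∈-concatPaths⇒edge xs v∈xs)) refl)

    last-concatPaths : ∀ x xs → last (concatMap path (x ∷ xs)) ≡ just (lastVertex (lastOf x xs))
    last-concatPaths x [] = trans (cong last (++-identityʳ (path x))) (last-tabulate (pathVertex x))
    last-concatPaths x (y ∷ ys) =
      trans (last-++-∷ (path x) (firstVertex y) _) (last-concatPaths y ys)

    concatPaths-Linked : ∀ xs → Linked Consecutive xs → Unique (map proj₁ xs) →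
                         Linked (L n) (concatMap path xs)
    concatPaths-Linked [] _ _ = []
    concatPaths-Linked (x ∷ []) _ _ =
      subst (Linked (L n)) (sym (++-identityʳ (path x))) (Linked-tabulate⁺ (pathVertex x) (path-step x))
    concatPaths-Linked (x ∷ y ∷ ys) (x→y ∷ linked) ((x≢y ∷ _) ∷ edges!) = Linked.++⁺
      (Linked-tabulate⁺ (pathVertex x) (path-step x))
      (subst (λ w → Connected (L n) w (just (firstVertex y))) (sym (last-tabulate (pathVertex x)))
             (just (Consecutive⇒L x y x→y x≢y)))
      (concatPaths-Linked (y ∷ ys) linked edges!)

    concatPaths-length : ∀ x y ys → 3 ≤ length (concatMap path (x ∷ y ∷ ys))
    concatPaths-length x y ys =
      subst (3 ≤_) (sym (length-++ (path x))) (s≤s (s≤s (≤-trans (s≤s z≤n) (m≤n+m _ _))))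

    EulerArcCycle⇒Hamiltonian : EulerArcCycle → Hamiltonian (L n)
    EulerArcCycle⇒Hamiltonian record { first = x ; rest = [] ; closing = closing } =
      ⊥-elim (Consecutive-irreflexive x closing)
    EulerArcCycle⇒Hamiltonian record { first = x ; rest = y ∷ ys ; linked = linked ; closing = closing
                                     ; edges! = edges!@(x∉ ∷ _) ; complete = complete } =
      Hamiltonian-fromList (concatMap path arcs)
        (concatPaths-length x y ys)
        (concatPaths-Unique arcs edges!)
        (λ (e , i) → ∈-concatPaths arcs e i (complete e))
        (concatPaths-Linked arcs linked edges!)
        (subst (λ w → Connected (L n) w (just (firstVertex x))) (sym (last-concatPaths x (y ∷ ys)))
               (just (Consecutive⇒L (lastOf x (y ∷ ys)) x closing last≢x)))
      where
      arcs = x ∷ y ∷ ys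
      last≢x : proj₁ (lastOf x (y ∷ ys)) ≢ proj₁ x
      last≢x eq = All.lookup x∉ (∈-map⁺ proj₁ (lastOf-∈ x y ys)) (sym eq)

  -- Dynamic trails and Euler arc cycles

  walkPositions : (W : Walk) → List (DynWalk.Pos W)
  walkPositions W = allPositions (suc (DynWalk.len W)) (DynWalk.mult W)

  -- Defined step by step, so that the constructions below extend it definitionally.
  walkEdges : Walk → List (Fin m)
  walkEdges W = concat (tabulate λ i → tabulate (DynWalk.edge W i))

  map-edgeAt-walkPositions : ∀ W → map (DynWalk.edgeAt W) (walkPositions W) ≡ walkEdges W
  map-edgeAt-walkPositions W = map-allPositions _ _ (DynWalk.edgeAt W)

  lastPosition : (W : Walk) → DynWalk.Pos W
  lastPosition W = fromℕ len , fromℕ (mult (fromℕ len))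
    where open DynWalk W

  last-walkPositions : ∀ W → last (walkPositions W) ≡ just (lastPosition W)
  last-walkPositions W = last-allPositions (DynWalk.len W) (DynWalk.mult W)

  last-walkEdges : ∀ W → last (walkEdges W) ≡ just (DynWalk.lastEdge W)
  last-walkEdges W = begin
    last (walkEdges W)                               ≡⟨ cong last (map-edgeAt-walkPositions W) ⟨
    last (map edgeAt (walkPositions W))              ≡⟨ last-map edgeAt (walkPositions W) ⟩
    Maybe.map edgeAt (last (walkPositions W))        ≡⟨ cong (Maybe.map edgeAt) (last-walkPositions W) ⟩
    just lastEdge                                    ∎
    where
    open DynWalk W
    open ≡-Reasoning

  joins-arc : ∀ x → Joins Adj p m src tgt c (proj₁ x) (start x) (end x)
  joins-arc (e , false) = inj₁ (refl , refl)
  joins-arc (e , true)  = inj₂ (refl , refl)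

  record Traces (x : Arc) (xs : List Arc) (W : Walk) : Set where
    open DynWalk W
    field
      vert-first  : vert zero ≡ start x
      vert-second : vert (suc zero) ≡ end x
      vert-last   : vert (fromℕ (suc len)) ≡ end (lastOf x xs)
      edges≡      : walkEdges W ≡ map proj₁ (x ∷ xs)

  traceArc : ∀ x → Σ Walk (Traces x [])
  traceArc x = W , record { vert-first = refl ; vert-second = refl ; vert-last = refl ; edges≡ = refl }
    where
    W : Walk
    W = record
      { len    = 0
      ; vert   = λ { zero → start x ; (suc _) → end x }
      ; mult   = λ _ → 0
      ; edge   = λ _ _ → proj₁ x
      ; joins  = λ { zero zero → joins-arc x }
      ; compat = λ ()
      }

  traceStep : ∀ x y ys → Σ Walk (Traces y ys) → end x ≡ start y → Adj (c (proj₁ x)) (c (proj₁ y)) →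
              Σ Walk (Traces x (y ∷ ys))
  traceStep x y ys (W , T) x→y adj = W′ , record
    { vert-first  = refl
    ; vert-second = trans (Traces.vert-first T) (sym x→y)
    ; vert-last   = Traces.vert-last T
    ; edges≡      = cong (proj₁ x ∷_) (Traces.edges≡ T)
    }
    where
    open DynWalk W
    vert′ : Fin (suc (suc (suc len))) → Fin p
    vert′ zero    = start x
    vert′ (suc i) = vert i
    mult′ : Fin (suc (suc len)) → ℕ
    mult′ zero    = 0
    mult′ (suc i) = mult i
    edge′ : ∀ i → Fin (suc (mult′ i)) → Fin m
    edge′ zero    _ = proj₁ x
    edge′ (suc i) j = edge i j
    joins′ : ∀ i j → Joins Adj p m src tgt c (edge′ i j) (vert′ (inject₁ i)) (vert′ (suc i))
    joins′ zero    zero = subst (Joins Adj p m src tgt c (proj₁ x) (start x))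
                                (trans x→y (sym (Traces.vert-first T))) (joins-arc x)
    joins′ (suc i) j    = joins i j
    compat′ : ∀ (i : Fin (suc len)) →
              Adj (c (edge′ (inject₁ i) (fromℕ (mult′ (inject₁ i))))) (c (edge′ (suc i) zero))
    compat′ zero    = subst (λ e → Adj (c (proj₁ x)) (c e)) (sym (just-injective (cong head (Traces.edges≡ T)))) adj
    compat′ (suc i) = compat i
    W′ : Walk
    W′ = record { len = suc len ; vert = vert′ ; mult = mult′ ; edge = edge′ ; joins = joins′ ; compat = compat′ }

  traceParallel : ∀ x y ys → Σ Walk (Traces y ys) → start x ≡ start y → end x ≡ end y →
                  Σ Walk (Traces x (y ∷ ys))
  traceParallel x y ys (W , T) start≡ end≡ = W′ , record
    { vert-first  = trans (Traces.vert-first T) (sym start≡)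
    ; vert-second = trans (Traces.vert-second T) (sym end≡)
    ; vert-last   = Traces.vert-last T
    ; edges≡      = cong (proj₁ x ∷_) (Traces.edges≡ T)
    }
    where
    open DynWalk W
    mult′ : Fin (suc len) → ℕ
    mult′ zero    = suc (mult zero)
    mult′ (suc i) = mult (suc i)
    edge′ : ∀ i → Fin (suc (mult′ i)) → Fin m
    edge′ zero    zero    = proj₁ x
    edge′ zero    (suc j) = edge zero j
    edge′ (suc i) j       = edge (suc i) j
    joins′ : ∀ i j → Joins Adj p m src tgt c (edge′ i j) (vert (inject₁ i)) (vert (suc i))
    joins′ zero    zero    = subst₂ (Joins Adj p m src tgt c (proj₁ x))
                                    (trans start≡ (sym (Traces.vert-first T)))
                                    (trans end≡ (sym (Traces.vert-second T))) (joins-arc x)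
    joins′ zero    (suc j) = joins zero j
    joins′ (suc i) j       = joins (suc i) j
    compat′ : ∀ (i : Fin len) →
              Adj (c (edge′ (inject₁ i) (fromℕ (mult′ (inject₁ i))))) (c (edge′ (suc i) zero))
    compat′ zero    = compat zero
    compat′ (suc i) = compat (suc i)
    W′ : Walk
    W′ = record { len = len ; vert = vert ; mult = mult′ ; edge = edge′ ; joins = joins′ ; compat = compat′ }

  trace : ∀ x xs → Linked Consecutive (x ∷ xs) → Σ Walk (Traces x xs)
  trace x []       _            = traceArc x
  trace x (y ∷ ys) (x→y ∷ linked) with x→y
  ... | inj₁ (end≡start , adj)    = traceStep x y ys (trace y ys linked) end≡start adj
  ... | inj₂ (start≡ , end≡ , _) = traceParallel x y ys (trace y ys linked) start≡ end≡

  EulerArcCycle⇒trail : EulerArcCycle → HasClosedEulerDynTrail Adj p m src tgt c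
  EulerArcCycle⇒trail E = W , isTrail , isEuler , isClosed closing
    where
    open EulerArcCycle E
    W = proj₁ (trace first rest linked)
    T = proj₂ (trace first rest linked)
    open DynWalk W
    positions≡ : map edgeAt (walkPositions W) ≡ map proj₁ (first ∷ rest)
    positions≡ = trans (map-edgeAt-walkPositions W) (Traces.edges≡ T)
    isTrail : IsTrail
    isTrail P Q = map-Unique⇒injective edgeAt (subst Unique (sym positions≡) edges!)
                    (∈-allPositions _ _ P) (∈-allPositions _ _ Q)
    isEuler : IsEuler
    isEuler e with ∈-map⁻ edgeAt (subst (e ∈_) (sym positions≡) (complete e))
    ... | P , _ , e≡ = P , sym e≡
    firstEdge≡ : firstEdge ≡ proj₁ first
    firstEdge≡ = just-injective (cong head (Traces.edges≡ T))
    lastEdge≡ : lastEdge ≡ proj₁ (lastOf first rest)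
    lastEdge≡ = just-injective (begin
      just lastEdge                        ≡⟨ last-walkEdges W ⟨
      last (walkEdges W)                   ≡⟨ cong last (Traces.edges≡ T) ⟩
      last (map proj₁ (first ∷ rest))      ≡⟨ last-map proj₁ (first ∷ rest) ⟩
      Maybe.map proj₁ (last (first ∷ rest)) ≡⟨ cong (Maybe.map proj₁) (last-∷ first rest) ⟩
      just (proj₁ (lastOf first rest))     ∎)
      where open ≡-Reasoning
    isClosed : Consecutive (lastOf first rest) first → IsClosed
    isClosed (inj₁ (end≡start , adj)) =
      inj₁ ( trans (Traces.vert-first T) (trans (sym end≡start) (sym (Traces.vert-last T)))
           , subst₂ (λ e g → Adj (c e) (c g)) (sym lastEdge≡) (sym firstEdge≡) adj)
    isClosed (inj₂ (_ , end≡ , ∥)) =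
      inj₂ ( trans (Traces.vert-second T) (trans (sym end≡) (sym (Traces.vert-last T)))
           , subst₂ _∥_ (sym lastEdge≡) (sym firstEdge≡) ∥)

  orientation : ∀ {e u w} → Joins Adj p m src tgt c e u w → Bool
  orientation (inj₁ _) = false
  orientation (inj₂ _) = true

  start-orientation : ∀ {e u w} (j : Joins Adj p m src tgt c e u w) → start (e , orientation j) ≡ u
  start-orientation (inj₁ (s≡u , _)) = s≡u
  start-orientation (inj₂ (_ , t≡u)) = t≡u

  end-orientation : ∀ {e u w} (j : Joins Adj p m src tgt c e u w) → end (e , orientation j) ≡ w
  end-orientation (inj₁ (_ , t≡w)) = t≡w
  end-orientation (inj₂ (s≡w , _)) = s≡w

  module WalkArcs (W : Walk) where
    open DynWalk W

    arcAt : Pos → Arc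
    arcAt (i , j) = edge i j , orientation (joins i j)

    start-arcAt : ∀ i j → start (arcAt (i , j)) ≡ vert (inject₁ i)
    start-arcAt i j = start-orientation (joins i j)

    end-arcAt : ∀ i j → end (arcAt (i , j)) ≡ vert (suc i)
    end-arcAt i j = end-orientation (joins i j)

    arcAt-within : IsTrail → ∀ i (j : Fin (mult i)) → Consecutive (arcAt (i , inject₁ j)) (arcAt (i , suc j))
    arcAt-within isTrail i j =
      inj₂ (start≡ , end≡ , distinct , aligned⇒SameEnds (arcAt (i , inject₁ j)) (arcAt (i , suc j)) start≡ end≡)
      where
      start≡ = trans (start-arcAt i (inject₁ j)) (sym (start-arcAt i (suc j)))
      end≡   = trans (end-arcAt i (inject₁ j)) (sym (end-arcAt i (suc j)))
      sameStep : ∀ {a b : Fin (suc (mult i))} → _≡_ {A = Pos} (i , a) (i , b) → a ≡ b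
      sameStep refl = refl
      distinct : edge i (inject₁ j) ≢ edge i (suc j)
      distinct = inject₁≢suc j ∘ sameStep ∘ isTrail (i , inject₁ j) (i , suc j)

    arcAt-across : ∀ (i : Fin len) →
                   Consecutive (arcAt (inject₁ i , fromℕ (mult (inject₁ i)))) (arcAt (suc i , zero))
    arcAt-across i = inj₁ (trans (end-arcAt (inject₁ i) _) (sym (start-arcAt (suc i) zero)) , compat i)

    arcAt-closing : IsClosed → Consecutive (arcAt (lastPosition W)) (arcAt (zero , zero))
    arcAt-closing (inj₁ (v₀≡vₙ , adj)) =
      inj₁ (trans (end-arcAt (fromℕ len) _) (trans (sym v₀≡vₙ) (sym (start-arcAt zero zero))) , adj)
    arcAt-closing (inj₂ (v₁≡vₙ , last∥first)) =
      inj₂ (proj₁ (∥⇒aligned lastArc firstArc last∥first end≢start) , end≡ , last∥first)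
      where
      lastArc  = arcAt (lastPosition W)
      firstArc = arcAt (zero , zero)
      end≡ : end lastArc ≡ end firstArc
      end≡ = trans (end-arcAt (fromℕ len) _) (trans (sym v₁≡vₙ) (sym (end-arcAt zero zero)))
      end≢start : end lastArc ≢ start firstArc
      end≢start eq = start≢end firstArc (trans (sym eq) end≡)

    laterArcs : List Arc
    laterArcs = map arcAt (tabulate (λ j → zero , suc j) ++ map shift (allPositions len (mult ∘ suc)))

    lastOf-laterArcs : lastOf (arcAt (zero , zero)) laterArcs ≡ arcAt (lastPosition W)
    lastOf-laterArcs = just-injective (begin
      just (lastOf (arcAt (zero , zero)) laterArcs) ≡⟨ last-∷ (arcAt (zero , zero)) laterArcs ⟨
      last (map arcAt (walkPositions W))            ≡⟨ last-map arcAt (walkPositions W) ⟩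
      Maybe.map arcAt (last (walkPositions W))      ≡⟨ cong (Maybe.map arcAt) (last-walkPositions W) ⟩
      just (arcAt (lastPosition W))                 ∎)
      where open ≡-Reasoning

  trail⇒EulerArcCycle : HasClosedEulerDynTrail Adj p m src tgt c → EulerArcCycle
  trail⇒EulerArcCycle (W , isTrail , isEuler , isClosed) = record
    { first    = arcAt (zero , zero)
    ; rest     = laterArcs
    ; linked   = Linked.map⁺ (Linked-allPositions len mult (λ P Q → Consecutive (arcAt P) (arcAt Q))
                                                  (arcAt-within isTrail) arcAt-across)
    ; closing  = subst (λ x → Consecutive x (arcAt (zero , zero))) (sym lastOf-laterArcs)
                       (arcAt-closing isClosed)
    ; edges!   = subst Unique (map-∘ (walkPositions W))
                       (Unique.map⁺ (isTrail _ _) (allPositions-Unique (suc len) mult))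
    ; complete = λ e → let P , edgeAt-P≡e = isEuler e in
                       subst (_∈ map proj₁ (map arcAt (walkPositions W))) edgeAt-P≡e
                             (subst (edgeAt P ∈_) (map-∘ (walkPositions W))
                                    (∈-map⁺ edgeAt (∈-allPositions _ _ P)))
    }
    where
    open DynWalk W
    open WalkArcs W

  -- Hamiltonian cycles of L n for n ≥ 3

  L-sym : Symmetric Adj → ∀ {n x y} → L n x y → L n y x
  L-sym _       (inj₁ (e≡g , inj₁ i≡1+j)) = inj₁ (sym e≡g , inj₂ i≡1+j)
  L-sym _       (inj₁ (e≡g , inj₂ j≡1+i)) = inj₁ (sym e≡g , inj₁ j≡1+i)
  L-sym Adj-sym (inj₂ (inj₁ (e≢g , u , x-u , y-u , adj))) = inj₂ (inj₁ (e≢g ∘ sym , u , y-u , x-u , Adj-sym adj))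
  L-sym _       (inj₂ (inj₂ (u , v , u≢v , x-u , y-v , e∥g))) =
    inj₂ (inj₂ (v , u , u≢v ∘ sym , y-v , x-u , ∥-sym e∥g))

  PathEnd : (n : ℕ) → Fin m × Fin n → Set
  PathEnd n (_ , i) = toℕ i ≡ 0 ⊎ toℕ i ≡ n ∸ 1

  EndOf⇒PathEnd : ∀ {n x u} → EndOf n x u → PathEnd n x
  EndOf⇒PathEnd (inj₁ (i≡0 , _))   = inj₁ i≡0
  EndOf⇒PathEnd (inj₂ (i≡n-1 , _)) = inj₂ i≡n-1

  L-view : ∀ {n x y} → L n x y →
           (proj₁ x ≡ proj₁ y × (toℕ (proj₂ x) ≡ suc (toℕ (proj₂ y)) ⊎ toℕ (proj₂ y) ≡ suc (toℕ (proj₂ x))))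
           ⊎ (proj₁ x ≢ proj₁ y × PathEnd n x × PathEnd n y)
  L-view (inj₁ samePath) = inj₁ samePath
  L-view (inj₂ (inj₁ (e≢g , _ , x-u , y-u , _))) = inj₂ (e≢g , EndOf⇒PathEnd x-u , EndOf⇒PathEnd y-u)
  L-view (inj₂ (inj₂ (_ , _ , _ , x-u , y-v , e≢g , _))) = inj₂ (e≢g , EndOf⇒PathEnd x-u , EndOf⇒PathEnd y-v)

  reverse : Arc → Arc
  reverse (e , d) = e , not d

  sameEdge⇒≡⊎reverse : ∀ a b → proj₁ a ≡ proj₁ b → a ≡ b ⊎ reverse a ≡ b
  sameEdge⇒≡⊎reverse (e , false) (.e , false) refl = inj₁ refl
  sameEdge⇒≡⊎reverse (e , false) (.e , true)  refl = inj₂ refl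
  sameEdge⇒≡⊎reverse (e , true)  (.e , false) refl = inj₂ refl
  sameEdge⇒≡⊎reverse (e , true)  (.e , true)  refl = inj₁ refl

  module Blocks (n₃ : ℕ) where

    n : ℕ
    n = suc (suc (suc n₃))

    indexOn : Bool → ℕ → ℕ
    indexOn false s = s
    indexOn true  s = n ∸ suc s

    -- v is vertex number s of the path of proj₁ a, counted from the start of a.
    record OnArc (v : Fin m × Fin n) (a : Arc) (s : ℕ) : Set where
      constructor onArc
      field
        edge≡  : proj₁ v ≡ proj₁ a
        index≡ : toℕ (proj₂ v) ≡ indexOn (proj₂ a) s

    OnArc-unique : ∀ {v w a s} → OnArc v a s → OnArc w a s → v ≡ w
    OnArc-unique (onArc e≡ i≡) (onArc e≡′ i≡′) = cong₂ _,_ (trans e≡ (sym e≡′)) (toℕ-injective (trans i≡ (sym i≡′)))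

    OnArc-reverse : ∀ {v a s} → s < n → OnArc v a s → OnArc v (reverse a) (n ∸ suc s)
    OnArc-reverse {a = _ , false} (s≤s s≤n-1) (onArc e≡ i≡) = onArc e≡ (trans i≡ (sym (m∸[m∸n]≡n s≤n-1)))
    OnArc-reverse {a = _ , true}  _            (onArc e≡ i≡) = onArc e≡ i≡

    OnArc-reverse-last : ∀ {v a} → OnArc v a (n ∸ 1) → OnArc v (reverse a) 0
    OnArc-reverse-last {v} {a} v-a =
      subst (OnArc v (reverse a)) (n∸n≡0 n₃) (OnArc-reverse {s = n ∸ 1} ≤-refl v-a)

    reverse-involutive : ∀ a → reverse (reverse a) ≡ a
    reverse-involutive (e , d) = cong (e ,_) (not-involutive d)

    inner⇒¬PathEnd : ∀ {v a s} → suc (suc s) < n → OnArc v a (suc s) → ¬ PathEnd n v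
    inner⇒¬PathEnd {a = _ , false} _ (onArc _ i≡) (inj₁ i≡0) = 1+n≢0 (trans (sym i≡) i≡0)
    inner⇒¬PathEnd {a = _ , false} (s≤s s+2<n) (onArc _ i≡) (inj₂ i≡n-1) =
      <-irrefl (trans (sym i≡) i≡n-1) s+2<n
    inner⇒¬PathEnd {a = _ , true} (s≤s (s≤s (s≤s s≤n₃))) (onArc _ i≡) (inj₁ i≡0) =
      1+n≢0 (trans (sym (+-∸-assoc 1 s≤n₃)) (trans (sym i≡) i≡0))
    inner⇒¬PathEnd {a = _ , true} {s} _ (onArc _ i≡) (inj₂ i≡n-1) =
      <⇒≢ (s≤s (m∸n≤m (suc n₃) s)) (trans (sym i≡) i≡n-1)

    L-inner : ∀ {v w a s} → suc (suc s) < n → OnArc v a (suc s) → L n v w →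
              OnArc w a s ⊎ OnArc w a (suc (suc s))
    L-inner {a = a} s+2<n v-a vw with L-view vw
    ... | inj₂ (_ , v-end , _) = ⊥-elim (inner⇒¬PathEnd {a = a} s+2<n v-a v-end)
    L-inner {a = _ , false} _ (onArc e≡ i≡) _ | inj₁ (v≡w , inj₁ i≡1+j) =
      inj₁ (onArc (trans (sym v≡w) e≡) (suc-injective (trans (sym i≡1+j) i≡)))
    L-inner {a = _ , false} _ (onArc e≡ i≡) _ | inj₁ (v≡w , inj₂ j≡1+i) =
      inj₂ (onArc (trans (sym v≡w) e≡) (trans j≡1+i (cong suc i≡)))
    L-inner {a = _ , true} (s≤s (s≤s (s≤s s≤n₃))) (onArc e≡ i≡) _ | inj₁ (v≡w , inj₁ i≡1+j) =
      inj₂ (onArc (trans (sym v≡w) e≡) (suc-injective (trans (sym i≡1+j) (trans i≡ (+-∸-assoc 1 s≤n₃)))))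
    L-inner {a = _ , true} (s≤s (s≤s (s≤s s≤n₃))) (onArc e≡ i≡) _ | inj₁ (v≡w , inj₂ j≡1+i) =
      inj₁ (onArc (trans (sym v≡w) e≡) (trans j≡1+i (trans (cong suc i≡) (sym (+-∸-assoc 1 (m≤n⇒m≤1+n s≤n₃))))))

    L-start : ∀ {v w a} → OnArc v a 0 → L n v w → proj₁ w ≡ proj₁ a → OnArc w a 1
    L-start v-a vw w≡a with L-view vw
    ... | inj₂ (v≢w , _) = ⊥-elim (v≢w (trans (OnArc.edge≡ v-a) (sym w≡a)))
    L-start {a = _ , false} (onArc _ i≡) _ w≡a | inj₁ (_ , inj₁ i≡1+j) = ⊥-elim (1+n≢0 (trans (sym i≡1+j) i≡))
    L-start {a = _ , false} (onArc _ i≡) _ w≡a | inj₁ (_ , inj₂ j≡1+i) = onArc w≡a (trans j≡1+i (cong suc i≡))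
    L-start {a = _ , true}  (onArc _ i≡) _ w≡a | inj₁ (_ , inj₁ i≡1+j) = onArc w≡a (suc-injective (trans (sym i≡1+j) i≡))
    L-start {w = w} {a = _ , true} (onArc _ i≡) _ w≡a | inj₁ (_ , inj₂ j≡1+i) =
      ⊥-elim (<-irrefl refl (subst (_< n) (trans j≡1+i (cong suc i≡)) (toℕ<n (proj₂ w))))

    jump⇒OnArc : ∀ {v w} → L n v w → proj₁ v ≢ proj₁ w → ∃ λ d → OnArc w (proj₁ w , d) 0
    jump⇒OnArc vw v≢w with L-view vw
    ... | inj₁ (v≡w , _)            = ⊥-elim (v≢w v≡w)
    ... | inj₂ (_ , _ , inj₁ j≡0)   = false , onArc refl j≡0
    ... | inj₂ (_ , _ , inj₂ j≡n-1) = true  , onArc refl j≡n-1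

    EndOf-last : ∀ {v a u} → OnArc v a (n ∸ 1) → EndOf n v u → u ≡ end a
    EndOf-last {a = _ , false} (onArc _ i≡)  (inj₁ (i≡0 , _))   = ⊥-elim (1+n≢0 (trans (sym i≡) i≡0))
    EndOf-last {a = _ , false} (onArc e≡ _)  (inj₂ (_ , tgt≡u)) = trans (sym tgt≡u) (cong tgt e≡)
    EndOf-last {a = _ , true}  (onArc e≡ _)  (inj₁ (_ , src≡u)) = trans (sym src≡u) (cong src e≡)
    EndOf-last {a = _ , true}  (onArc _ i≡)  (inj₂ (i≡n-1 , _)) =
      ⊥-elim (1+n≢0 (trans (sym i≡n-1) (trans i≡ (n∸n≡0 n₃))))

    EndOf-first : ∀ {v a u} → OnArc v a 0 → EndOf n v u → u ≡ start a
    EndOf-first {a = _ , false} (onArc e≡ _)  (inj₁ (_ , src≡u)) = trans (sym src≡u) (cong src e≡)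
    EndOf-first {a = _ , false} (onArc _ i≡)  (inj₂ (i≡n-1 , _)) = ⊥-elim (1+n≢0 (trans (sym i≡n-1) i≡))
    EndOf-first {a = _ , true}  (onArc _ i≡)  (inj₁ (i≡0 , _))   = ⊥-elim (1+n≢0 (trans (sym i≡) i≡0))
    EndOf-first {a = _ , true}  (onArc e≡ _)  (inj₂ (_ , tgt≡u)) = trans (sym tgt≡u) (cong tgt e≡)

    jump⇒Consecutive : ∀ {v w a b} → L n v w → proj₁ v ≢ proj₁ w → OnArc v a (n ∸ 1) → OnArc w b 0 →
                       Consecutive a b
    jump⇒Consecutive (inj₁ (v≡w , _)) v≢w _ _ = ⊥-elim (v≢w v≡w)
    jump⇒Consecutive (inj₂ (inj₁ (_ , _ , v-u , w-u , adj))) _ v-a w-b =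
      inj₁ ( trans (sym (EndOf-last v-a v-u)) (EndOf-first w-b w-u)
           , subst₂ (λ e g → Adj (c e) (c g)) (OnArc.edge≡ v-a) (OnArc.edge≡ w-b) adj)
    jump⇒Consecutive {a = a} {b} (inj₂ (inj₂ (u , u′ , u≢u′ , v-u , w-u′ , v∥w))) _ v-a w-b =
      inj₂ (proj₁ aligned , proj₂ aligned , a∥b)
      where
      a∥b : proj₁ a ∥ proj₁ b
      a∥b = subst₂ _∥_ (OnArc.edge≡ v-a) (OnArc.edge≡ w-b) v∥w
      aligned = ∥⇒aligned a b a∥b λ eq →
        u≢u′ (trans (EndOf-last v-a v-u) (trans eq (sym (EndOf-first w-b w-u′))))

    OnArc-≡ : ∀ {v w a s} → v ≡ w → OnArc v a s → OnArc w a s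
    OnArc-≡ refl v-a = v-a

    OnArc-arc : ∀ {v a b s} → a ≡ b → OnArc v a s → OnArc v b s
    OnArc-arc refl v-a = v-a

    module FromHamiltonian (Adj-sym : Symmetric Adj) (H : Hamiltonian (L n)) where
      open CyclicIndexing H

      Jump : ℕ → Set
      Jump k = proj₁ (at k) ≢ proj₁ (at (suc k))

      at-step⁻ : ∀ k → L n (at (suc k)) (at k)
      at-step⁻ k = L-sym Adj-sym (at-step k)

      no-return : ∀ k → at k ≢ at (suc (suc k))
      no-return k eq = at-distinct 2 k (s≤s z≤n) (s≤s (s≤s (s≤s z≤n))) (sym eq)

      at-OnArc : ∀ {i j a s} → i ≡ j → OnArc (at i) a s → OnArc (at j) a s
      at-OnArc eq = OnArc-≡ (cong at eq)

      indexOn-1<n : ∀ d → indexOn d 1 < n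
      indexOn-1<n false = s≤s (s≤s z≤n)
      indexOn-1<n true  = n≤1+n (suc (suc n₃))

      -- Vertex 1 of a sits between its cycle-neighbours, which are vertices 0 and 2 of a;
      -- vertex 0 cannot come after it, since k is a jump.
      jump-continues : ∀ {k a} → Jump k → OnArc (at (suc k)) a 0 → proj₁ (at (suc (suc k))) ≡ proj₁ a
      jump-continues {k} {a} jump k+1-a with at-suc-surjective (proj₁ a , fromℕ< (indexOn-1<n (proj₂ a)))
      ... | Q , Q+1≡ = continue (L-inner (s≤s (s≤s (s≤s z≤n))) Q+1-a (at-step⁻ Q))
                                (L-inner (s≤s (s≤s (s≤s z≤n))) Q+1-a (at-step (suc Q)))
        where
        Q+1-a : OnArc (at (suc Q)) a 1
        Q+1-a = OnArc-≡ (sym Q+1≡) (onArc refl (toℕ-fromℕ< _))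
        continue : OnArc (at Q) a 0 ⊎ OnArc (at Q) a 2 →
                   OnArc (at (suc (suc Q))) a 0 ⊎ OnArc (at (suc (suc Q))) a 2 →
                   proj₁ (at (suc (suc k))) ≡ proj₁ a
        continue (inj₁ Q-a) _ =
          trans (cong proj₁ (sym (at-suc-cong (OnArc-unique Q-a k+1-a)))) (OnArc.edge≡ Q+1-a)
        continue (inj₂ _) (inj₁ Q+2-a) = ⊥-elim (jump (begin
          proj₁ (at k)           ≡⟨ cong proj₁ (at-suc-injective (OnArc-unique Q+2-a k+1-a)) ⟨
          proj₁ (at (suc Q))     ≡⟨ OnArc.edge≡ Q+1-a ⟩
          proj₁ a                ≡⟨ OnArc.edge≡ k+1-a ⟨
          proj₁ (at (suc k))     ∎))
          where open ≡-Reasoning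
        continue (inj₂ Q-a) (inj₂ Q+2-a) = ⊥-elim (no-return Q (OnArc-unique Q-a Q+2-a))

      runAlong : ∀ {k a} → OnArc (at (suc k)) a 0 → OnArc (at (suc (suc k))) a 1 →
              ∀ s → suc s < n → OnArc (at (suc k + s)) a s × OnArc (at (suc k + suc s)) a (suc s)
      runAlong {k} k+1-a k+2-a zero _ =
        at-OnArc (sym (+-identityʳ (suc k))) k+1-a , at-OnArc (cong suc (+-comm 1 k)) k+2-a
      runAlong {k} {a} k+1-a k+2-a (suc s) s+2<n = extend (runAlong k+1-a k+2-a s (≤-trans (n≤1+n _) s+2<n))
        where
        extend : OnArc (at (suc k + s)) a s × OnArc (at (suc k + suc s)) a (suc s) →
                 OnArc (at (suc k + suc s)) a (suc s) × OnArc (at (suc k + suc (suc s))) a (suc (suc s))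
        extend (here-a , next-a) with L-inner s+2<n next-a (at-step (suc k + suc s))
        ... | inj₁ back  = ⊥-elim (no-return (suc k + s) (trans (OnArc-unique here-a back)
                                                               (cong at (cong suc (+-suc (suc k) s)))))
        ... | inj₂ ahead = next-a , at-OnArc (sym (+-suc (suc k) (suc s))) ahead

      record Block (k : ℕ) : Set where
        field
          arc      : Arc
          vertices : ∀ s → s < n → OnArc (at (suc k + s)) arc s
          next     : Jump (k + n)

      block : ∀ {k} → Jump k → Block k
      block {k} jump = record { arc = a ; vertices = vertices ; next = next }
        where
        a : Arc
        a = proj₁ (at (suc k)) , proj₁ (jump⇒OnArc (at-step k) jump)
        k+1-a : OnArc (at (suc k)) a 0
        k+1-a = proj₂ (jump⇒OnArc (at-step k) jump)
        k+2-a : OnArc (at (suc (suc k))) a 1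
        k+2-a = L-start k+1-a (at-step (suc k)) (jump-continues jump k+1-a)
        vertices : ∀ s → s < n → OnArc (at (suc k + s)) a s
        vertices zero    _   = proj₁ (runAlong k+1-a k+2-a zero (s≤s (s≤s z≤n)))
        vertices (suc s) s<n = proj₂ (runAlong k+1-a k+2-a s s<n)
        -- Otherwise the path of a would be re-entered backwards right after it ends.
        next : Jump (k + n)
        next same = no-return (suc k + suc n₃) (trans (OnArc-unique (vertices (suc n₃) (n≤1+n _)) k+n+1-a)
                                                      (cong at k+n+1≡))
          where
          k+n-a : OnArc (at (k + n)) a (n ∸ 1)
          k+n-a = at-OnArc (sym (+-suc k (suc (suc n₃)))) (vertices (n ∸ 1) ≤-refl)
          k+n+1-ā : OnArc (at (suc (k + n))) (reverse a) 1
          k+n+1-ā = L-start (OnArc-reverse-last k+n-a) (at-step (k + n)) (trans (sym same) (OnArc.edge≡ k+n-a))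
          k+n+1-a : OnArc (at (suc (k + n))) a (suc n₃)
          k+n+1-a = OnArc-arc (reverse-involutive a) (OnArc-reverse (s≤s (s≤s z≤n)) k+n+1-ā)
          k+n+1≡ : suc (k + n) ≡ suc (suc (suc k + suc n₃))
          k+n+1≡ = cong suc (trans (+-suc k _) (cong suc (+-suc k _)))

      some-jump : ∃ Jump
      some-jump with at-suc-surjective (proj₁ (at 0) , zero)
      ... | Q , Q+1≡ with proj₁ (at Q) Fin.≟ proj₁ (at 0) | proj₁ (at (suc (suc Q))) Fin.≟ proj₁ (at 0)
      ... | no  Q≢   | _          = Q , λ eq → Q≢ (trans eq (cong proj₁ Q+1≡))
      ... | yes _    | no  Q+2≢   = suc Q , λ eq → Q+2≢ (trans (sym eq) (cong proj₁ Q+1≡))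
      ... | yes Q≡   | yes Q+2≡   = ⊥-elim (no-return Q (OnArc-unique (L-start Q+1-a (at-step⁻ Q) Q≡)
                                                                     (L-start Q+1-a (at-step (suc Q)) Q+2≡)))
        where
        Q+1-a : OnArc (at (suc Q)) (proj₁ (at 0) , false) 0
        Q+1-a = OnArc-≡ (sym Q+1≡) (onArc refl refl)

      blockEnd : ∀ k t → k + t * n + n ≡ k + suc t * n
      blockEnd k t = trans (+-assoc k (t * n) n) (cong (k +_) (+-comm (t * n) n))

      opaque
        firstJump : ℕ
        firstJump = proj₁ some-jump

        jumpAt : ∀ t → Jump (firstJump + t * n)
        jumpAt zero    = subst Jump (sym (+-identityʳ firstJump)) (proj₂ some-jump)
        jumpAt (suc t) = subst Jump (blockEnd firstJump t) (Block.next (block (jumpAt t)))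

        blockArc : ℕ → Arc
        blockArc t = Block.arc (block (jumpAt t))

        blockArc-vertices : ∀ t s → s < n → OnArc (at (suc (firstJump + t * n) + s)) (blockArc t) s
        blockArc-vertices t = Block.vertices (block (jumpAt t))

      blockArc-last : ∀ t → OnArc (at (firstJump + suc t * n)) (blockArc t) (n ∸ 1)
      blockArc-last t = at-OnArc (trans (sym (+-suc (firstJump + t * n) (suc (suc n₃)))) (blockEnd firstJump t))
                                 (blockArc-vertices t (n ∸ 1) ≤-refl)

      blockArc-Consecutive : ∀ t {k b} → at (suc (firstJump + suc t * n)) ≡ at k → OnArc (at k) b 0 →
                             Consecutive (blockArc t) b
      blockArc-Consecutive t eq k-b =
        jump⇒Consecutive (at-step _) (jumpAt (suc t)) (blockArc-last t) (OnArc-≡ (sym eq) k-b)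

      blockArc-Consecutive-suc : ∀ t → Consecutive (blockArc t) (blockArc (suc t))
      blockArc-Consecutive-suc t =
        blockArc-Consecutive t (cong at (sym (+-identityʳ _))) (blockArc-vertices (suc t) 0 (s≤s z≤n))

      edgeCount : ∃ λ m₁ → m ≡ suc m₁
      edgeCount = nonzero m (cycle-length H)
        where
        nonzero : ∀ k → N ≡ k * n → ∃ λ k₁ → k ≡ suc k₁
        nonzero zero    ()
        nonzero (suc k) _ = k , refl

      m₁ : ℕ
      m₁ = proj₁ edgeCount

      m≡1+m₁ : m ≡ suc m₁
      m≡1+m₁ = proj₂ edgeCount

      -- After the m blocks, each of n vertices, the cycle is back at its start.
      blockArc-closing : Consecutive (blockArc m₁) (blockArc 0)
      blockArc-closing = blockArc-Consecutive m₁ (begin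
        at (suc (firstJump + suc m₁ * n))    ≡⟨ cong (λ k → at (suc (firstJump + k))) 1+m₁*n≡N ⟩
        at (suc (firstJump + N))             ≡⟨ at-suc-cong (at-periodic firstJump) ⟩
        at (suc firstJump)                   ≡⟨ cong (at ∘ suc) (trans (+-identityʳ _) (+-identityʳ _)) ⟨
        at (suc (firstJump + 0 * n) + 0)     ∎) (blockArc-vertices 0 0 (s≤s z≤n))
        where
        open ≡-Reasoning
        1+m₁*n≡N : suc m₁ * n ≡ N
        1+m₁*n≡N = trans (cong (_* n) (sym m≡1+m₁)) (sym (cycle-length H))

      blockEdge : ℕ → Fin m
      blockEdge t = proj₁ (blockArc t)

      blocks-disjoint : ∀ i u s → s < n → suc u + i < m →
                        at (suc (firstJump + i * n) + 0) ≢ at (suc (firstJump + (suc u + i) * n) + s)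
      blocks-disjoint i u s s<n u+i<m eq =
        at-distinct (suc u * n + s) (suc (firstJump + i * n) + 0) (s≤s z≤n) δ<N
          (sym (trans eq (cong at (position firstJump i u n s))))
        where
        position : ∀ k i u n s → suc (k + (suc u + i) * n) + s ≡ (suc u * n + s) + (suc (k + i * n) + 0)
        position = solve-∀
        δ<N : suc u * n + s < N
        δ<N = subst (suc u * n + s <_) (sym (cycle-length H))
          (≤-trans (+-monoʳ-< (suc u * n) s<n)
          (≤-trans (≤-reflexive (+-comm (suc u * n) n))
                   (*-monoˡ-≤ n (≤-trans (s≤s (m≤m+n (suc u) i)) u+i<m))))

      blockEdge-distinct : ∀ i u → suc u + i < m → blockEdge i ≢ blockEdge (suc u + i)
      blockEdge-distinct i u u+i<m eq with sameEdge⇒≡⊎reverse (blockArc (suc u + i)) (blockArc i) (sym eq)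
      ... | inj₁ j≡i = blocks-disjoint i u 0 (s≤s z≤n) u+i<m
        (OnArc-unique (blockArc-vertices i 0 (s≤s z≤n))
                      (OnArc-arc j≡i (blockArc-vertices (suc u + i) 0 (s≤s z≤n))))
      ... | inj₂ j̄≡i = blocks-disjoint i u (n ∸ 1) ≤-refl u+i<m
        (OnArc-unique (blockArc-vertices i 0 (s≤s z≤n))
                      (OnArc-arc j̄≡i (OnArc-reverse-last (blockArc-vertices (suc u + i) (n ∸ 1) ≤-refl))))

      blockEdge-distinct-< : ∀ {i j} → i < j → j < m → blockEdge i ≢ blockEdge j
      blockEdge-distinct-< {i} {j} i<j j<m eq =
        blockEdge-distinct i (j ∸ suc i) (subst (_< m) (sym j≡) j<m) (trans eq (cong blockEdge (sym j≡)))
        where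
        j≡ : suc (j ∸ suc i) + i ≡ j
        j≡ = trans (sym (+-suc (j ∸ suc i) i)) (m∸n+n≡m i<j)

      blockEdge-injective : ∀ {i j} → i < m → j < m → blockEdge i ≡ blockEdge j → i ≡ j
      blockEdge-injective {i} {j} i<m j<m eq with <-cmp i j
      ... | tri< i<j _ _ = ⊥-elim (blockEdge-distinct-< i<j j<m eq)
      ... | tri≈ _ i≡j _ = i≡j
      ... | tri> _ _ j<i = ⊥-elim (blockEdge-distinct-< j<i i<m (sym eq))

      blockEdge-surjective : ∀ e → ∃ λ t → t < m × blockEdge t ≡ e
      blockEdge-surjective e =
        let t , t≡ = injective⇒surjective (blockEdge ∘ toℕ)
                       (λ {x} {y} eq → toℕ-injective (blockEdge-injective (toℕ<n x) (toℕ<n y) eq)) e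
        in toℕ t , toℕ<n t , t≡

      eulerArcCycle : EulerArcCycle
      eulerArcCycle = record
        { first    = blockArc 0
        ; rest     = applyUpTo (blockArc ∘ suc) m₁
        ; linked   = Linked.applyUpTo⁺₂ blockArc (suc m₁) blockArc-Consecutive-suc
        ; closing  = subst (λ a → Consecutive a (blockArc 0)) (sym (lastOf-applyUpTo blockArc m₁)) blockArc-closing
        ; edges!   = subst Unique (sym (map-applyUpTo blockArc proj₁ (suc m₁)))
                       (Unique.applyUpTo⁺₁ blockEdge (suc m₁)
                          λ i<j j<1+m₁ → blockEdge-distinct-< i<j (subst (_ <_) (sym m≡1+m₁) j<1+m₁))
        ; complete = λ e → let t , t<m , t≡ = blockEdge-surjective e in
            subst (e ∈_) (sym (map-applyUpTo blockArc proj₁ (suc m₁)))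
                  (subst (_∈ applyUpTo blockEdge (suc m₁)) t≡
                         (∈-applyUpTo⁺ blockEdge (subst (t <_) m≡1+m₁ t<m)))
        }

theorem7 : {VH : Set} (Adj : VH → VH → Set) → Symmetric Adj →
           (p m : ℕ) (src tgt : Fin m → Fin p) → (∀ e → src e ≢ tgt e) →
           (c : Fin m → VH) →
           (HasClosedEulerDynTrail Adj p m src tgt c →
             ∀ n → 2 ≤ n → Hamiltonian (LAdj Adj p m src tgt c n))
           × ((∃ λ n → 3 ≤ n × Hamiltonian (LAdj Adj p m src tgt c n)) →
             HasClosedEulerDynTrail Adj p m src tgt c)
           × (HasClosedEulerDynTrail Adj p m src tgt c ⇔
             (∀ n → 3 ≤ n → Hamiltonian (LAdj Adj p m src tgt c n)))
theorem7 Adj Adj-sym p m src tgt loopless c =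
  trail⇒Hamiltonian , Hamiltonian⇒trail ,
  mk⇔ (λ trail n 3≤n → trail⇒Hamiltonian trail n (≤-trans (n≤1+n 2) 3≤n))
      (λ hamiltonian → Hamiltonian⇒trail (3 , ≤-refl , hamiltonian 3 ≤-refl))
  where
  open LineGraph Adj p m src tgt loopless c

  trail⇒Hamiltonian : HasClosedEulerDynTrail Adj p m src tgt c → ∀ n → 2 ≤ n → Hamiltonian (L n)
  trail⇒Hamiltonian trail (suc (suc n′)) (s≤s (s≤s z≤n)) =
    Paths.EulerArcCycle⇒Hamiltonian n′ (trail⇒EulerArcCycle trail)

  Hamiltonian⇒trail : (∃ λ n → 3 ≤ n × Hamiltonian (L n)) → HasClosedEulerDynTrail Adj p m src tgt c
  Hamiltonian⇒trail (suc (suc (suc n₃)) , s≤s (s≤s (s≤s z≤n)) , hamiltonian) =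
    EulerArcCycle⇒trail (Blocks.FromHamiltonian.eulerArcCycle n₃ Adj-sym hamiltonian)
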